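{- Let $(C_n,S)$ be an instance of cycle VCA and $S'\subseteq S$. Then $S'$ is feasible if and only if every chord of $C_n$ is crossed by some link of $S'$. Consequently, if $S'$ is feasible, then every vertex of $C_n$ is incident to some link of $S'$ and $|S'|\ge n/2$.
   Context: Let $n\ge 4$ and let $C_n$ be the cycle on $[n]$ with edges $\{i,i+1\}$ and $\{n,1\}$. A chord is an edge between two non-consecutive vertices of $C_n$ (the set of all chords of $C_n$ includes chords not in $S$). Chords $ab$, $cd$ with $a<b$, $c<d$ cross if $a,b,c,d$ are distinct and $c<a<d<b$ or $a<c<b<d$; chords sharing an endpoint do not cross. An instance of cycle VCA is a pair $(C_n,S)$, $S$ a set of chords (links) with $C_n\cup S$ 3-vertex-connected; $S'\subseteq S$ is feasible if $C_n\cup S'$ is 3-vertex-connected. -}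

module Defs where

open import Data.Nat using (ℕ; zero; suc; _+_; _*_; _≤_; _<_)
open import Data.List using (List; length)
open import Data.List.Membership.Propositional using (_∈_; _∉_)
open import Data.Product using (_×_; _,_; Σ; ∃)
open import Data.Sum using (_⊎_)
open import Relation.Binary.PropositionalEquality using (_≡_; _≢_)
open import Relation.Nullary using (¬_)

Vertex : ℕ → ℕ → Set
Vertex n v = 1 ≤ v × v ≤ n

CycleEdge : ℕ → ℕ → ℕ → Set
CycleEdge n u v =
  (Vertex n u × v ≡ suc u × v ≤ n) ⊎
  (Vertex n v × u ≡ suc v × u ≤ n) ⊎
  (u ≡ 1 × v ≡ n) ⊎ (u ≡ n × v ≡ 1)

-- A pair ab (a<b) is a chord of C_n: both vertices, non-consecutive on the cycle.
-- Chords/links are stored as ordered pairs (a , b) with a < b.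
IsChord : ℕ → ℕ × ℕ → Set
IsChord n (a , b) = 1 ≤ a × a < b × b ≤ n × suc a ≢ b × ¬ (a ≡ 1 × b ≡ n)

-- Crossing of chords ab, cd (a<b, c<d): a,b,c,d distinct and c<a<d<b or a<c<b<d.
-- (Distinctness is implied by the strict inequalities.)
Cross : ℕ × ℕ → ℕ × ℕ → Set
Cross (a , b) (c , d) = (c < a × a < d × d < b) ⊎ (a < c × c < b × b < d)

Adj : ℕ → List (ℕ × ℕ) → ℕ → ℕ → Set
Adj n L u v = CycleEdge n u v ⊎ (u , v) ∈ L ⊎ (v , u) ∈ L

data Walk (P : ℕ → Set) (E : ℕ → ℕ → Set) : ℕ → ℕ → Set where
  here : ∀ {u} → Walk P E u u
  step : ∀ {u w v} → E u w → P w → Walk P E w v → Walk P E u v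

ConnectedMinus : ℕ → List (ℕ × ℕ) → List ℕ → Set
ConnectedMinus n L X =
  ∀ u v → Vertex n u → u ∉ X → Vertex n v → v ∉ X →
  Walk (λ w → Vertex n w × w ∉ X) (Adj n L) u v

ThreeConnected : ℕ → List (ℕ × ℕ) → Set
ThreeConnected n L = 3 < n × (∀ (X : List ℕ) → length X ≤ 2 → ConnectedMinus n L X)

Feasible : ℕ → List (ℕ × ℕ) → Set
Feasible = ThreeConnected

Incident : ℕ → ℕ × ℕ → Set
Incident v (a , b) = v ≡ a ⊎ v ≡ b

{-# OPTIONS --safe #-}
module Submission where

-- Deleting two vertices p < q from C_n leaves the arc strictly between p and q and the
-- arc through the edge {n,1}; each arc is connected along the cycle, and a link joins the
-- two arcs exactly when it crosses the chord pq. The links crossing the chord between the two neighbours of v are exactly the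
-- links at v, so every vertex is covered and counting endpoints gives n ≤ 2|S′|.

open import Defs
open import Data.Nat using (ℕ; zero; suc; _+_; _*_; _≤_; _<_; z≤n; s≤s; z<s; _≤?_; _<?_; _≟_)
open import Data.Nat.Properties
open import Data.List using (List; []; _∷_; _++_; map; length)
open import Data.List.Properties using (length-++; length-++-sucʳ; length-map)
open import Data.List.Relation.Unary.All using (All)
import Data.List.Relation.Unary.All as All
open import Data.List.Relation.Unary.Any using (here; there)
open import Data.List.Relation.Unary.Unique.Propositional using (Unique)
open import Data.List.Membership.Propositional using (_∈_; _∉_)
open import Data.List.Membership.Propositional.Properties using (∈-∃++; ∈-++⁻; ∈-++⁺ˡ; ∈-++⁺ʳ; ∈-map⁺)
open import Data.Product using (_×_; Σ; ∃; ∃₂; _,_; proj₁; proj₂; swap)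
open import Data.Sum using (_⊎_; inj₁; inj₂)
open import Data.Empty using (⊥-elim)
open import Function using (_∘_; flip)
open import Function.Bundles using (_⇔_; mk⇔)
open import Relation.Binary using (tri<; tri≈; tri>)
open import Relation.Binary.PropositionalEquality using (_≡_; _≢_; refl; sym; cong; cong₂; subst; module ≡-Reasoning)
open import Relation.Nullary using (¬_; yes; no)
open import Relation.Nullary.Decidable using (_×-dec_)
open import Relation.Unary using (_⊆_; Decidable)

AllChordsCrossed : ℕ → List (ℕ × ℕ) → Set
AllChordsCrossed n L = ∀ c → IsChord n c → Σ (ℕ × ℕ) (λ l → l ∈ L × Cross l c)

module _ {P : ℕ → Set} {E : ℕ → ℕ → Set} where

  infixr 5 _◅◅_

  _◅◅_ : ∀ {u v w} → Walk P E u v → Walk P E v w → Walk P E u w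
  here         ◅◅ q = q
  step e pw r  ◅◅ q = step e pw (r ◅◅ q)

  reverse : (∀ {u v} → E u v → E v u) → ∀ {u v} → P u → Walk P E u v → Walk P E v u
  reverse sym-E pu here          = here
  reverse sym-E pu (step e pw r) = reverse sym-E pw r ◅◅ step (sym-E e) pu here

  map-walk : ∀ {Q} → P ⊆ Q → ∀ {u v} → Walk P E u v → Walk Q E u v
  map-walk P⊆Q here          = here
  map-walk P⊆Q (step e pw r) = step e (P⊆Q pw) (map-walk P⊆Q r)

  walk-exits : (Q : ℕ → Set) → Decidable Q → ∀ {u v} → Walk P E u v → Q u → ¬ Q v →
               ∃₂ λ w w′ → Q w × E w w′ × ¬ Q w′ × P w′
  walk-exits Q Q? here qu ¬qv = ⊥-elim (¬qv qu)
  walk-exits Q Q? {u} (step {w = m} e pm r) qu ¬qv with Q? m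
  ... | yes qm = walk-exits Q Q? r qm ¬qv
  ... | no ¬qm = u , m , qu , e , ¬qm , pm

Adj-sym : ∀ {n L u v} → Adj n L u v → Adj n L v u
Adj-sym (inj₁ (inj₁ e))               = inj₁ (inj₂ (inj₁ e))
Adj-sym (inj₁ (inj₂ (inj₁ e)))        = inj₁ (inj₁ e)
Adj-sym (inj₁ (inj₂ (inj₂ (inj₁ e)))) = inj₁ (inj₂ (inj₂ (inj₂ (swap e))))
Adj-sym (inj₁ (inj₂ (inj₂ (inj₂ e)))) = inj₁ (inj₂ (inj₂ (inj₁ (swap e))))
Adj-sym (inj₂ (inj₁ m))               = inj₂ (inj₂ m)
Adj-sym (inj₂ (inj₂ m))               = inj₂ (inj₁ m)

∉-pair⁻ : ∀ {w p q : ℕ} → w ∉ p ∷ q ∷ [] → w ≢ p × w ≢ q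
∉-pair⁻ w∉ = w∉ ∘ here , w∉ ∘ there ∘ here

∉-pair⁺ : ∀ {w p q : ℕ} → w ≢ p → w ≢ q → w ∉ p ∷ q ∷ []
∉-pair⁺ w≢p w≢q (here w≡p)         = w≢p w≡p
∉-pair⁺ w≢p w≢q (there (here w≡q)) = w≢q w≡q

Convex : (ℕ → Set) → Set
Convex R = ∀ {u v w} → R u → R v → u ≤ w → w ≤ v → R w

Within : ℕ → ℕ → ℕ → Set
Within a b w = a < w × w < b

vertex-between : ∀ {n u v w} → Vertex n u → Vertex n v → u ≤ w → w ≤ v → Vertex n w
vertex-between (1≤u , _) (_ , v≤n) u≤w w≤v = ≤-trans 1≤u u≤w , ≤-trans w≤v v≤n

Below Above : ℕ → ℕ → ℕ → Set
Below n p w = Vertex n w × w < p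
Above n q w = Vertex n w × q < w

Inner Outer : ℕ → ℕ → ℕ → ℕ → Set
Inner n p q w = Vertex n w × Within p q w
Outer n p q w = Below n p w ⊎ Above n q w

inner-convex : ∀ {n p q} → Convex (Inner n p q)
inner-convex (Vu , p<u , _) (Vv , _ , v<q) u≤w w≤v =
  vertex-between Vu Vv u≤w w≤v , <-≤-trans p<u u≤w , ≤-<-trans w≤v v<q

below-convex : ∀ {n p} → Convex (Below n p)
below-convex (Vu , _) (Vv , v<p) u≤w w≤v = vertex-between Vu Vv u≤w w≤v , ≤-<-trans w≤v v<p

above-convex : ∀ {n q} → Convex (Above n q)
above-convex (Vu , q<u) (Vv , _) u≤w w≤v = vertex-between Vu Vv u≤w w≤v , <-≤-trans q<u u≤w

module CycleWalks (n : ℕ) (L : List (ℕ × ℕ)) {P : ℕ → Set} (P⇒Vertex : P ⊆ Vertex n) where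

  infix 4 _⇝_

  _⇝_ : ℕ → ℕ → Set
  u ⇝ v = Walk P (Adj n L) u v

  ascending-walk : ∀ {u v} → u ≤ v → (∀ {w} → u ≤ w → w ≤ v → P w) → u ⇝ v
  ascending-walk {v = zero} z≤n inP = here
  ascending-walk {v = suc v} u≤1+v inP with m≤n⇒m<n∨m≡n u≤1+v
  ... | inj₂ refl      = here
  ... | inj₁ (s≤s u≤v) =
    ascending-walk u≤v (λ u≤w w≤v → inP u≤w (m≤n⇒m≤1+n w≤v)) ◅◅ step edge P[1+v] here
    where
    P[1+v] : P (suc v)
    P[1+v] = inP u≤1+v ≤-refl
    edge : Adj n L v (suc v)
    edge = inj₁ (inj₁ (P⇒Vertex (inP u≤v (n≤1+n v)) , refl , proj₂ (P⇒Vertex P[1+v])))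

  convex-walk : ∀ {R} → Convex R → R ⊆ P → ∀ {u v} → R u → R v → u ⇝ v
  convex-walk convex R⊆P {u} {v} Ru Rv with ≤-total u v
  ... | inj₁ u≤v = ascending-walk u≤v (λ u≤w w≤v → R⊆P (convex Ru Rv u≤w w≤v))
  ... | inj₂ v≤u = reverse Adj-sym (R⊆P Rv)
                     (ascending-walk v≤u (λ v≤w w≤u → R⊆P (convex Rv Ru v≤w w≤u)))

  wrap-walk : ∀ {a b} → 1 ≤ a → b ≤ n →
              (∀ {w} → 1 ≤ w → w ≤ a → P w) → (∀ {w} → b ≤ w → w ≤ n → P w) → a ⇝ b
  wrap-walk 1≤a b≤n lowP highP =
    reverse Adj-sym (lowP ≤-refl 1≤a) (ascending-walk 1≤a lowP)
      ◅◅ step (inj₁ (inj₂ (inj₂ (inj₁ (refl , refl))))) (highP b≤n ≤-refl)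
           (reverse Adj-sym (highP ≤-refl b≤n) (ascending-walk b≤n highP))

  below-to-above : ∀ {p q} → Outer n p q ⊆ P → ∀ {a b} → Below n p a → Above n q b → a ⇝ b
  below-to-above O⊆P ((1≤a , a≤n) , a<p) ((1≤b , b≤n) , q<b) =
    wrap-walk 1≤a b≤n
      (λ 1≤w w≤a → O⊆P (inj₁ ((1≤w , ≤-trans w≤a a≤n) , ≤-<-trans w≤a a<p)))
      (λ b≤w w≤n → O⊆P (inj₂ ((≤-trans 1≤b b≤w , w≤n) , <-≤-trans q<b b≤w)))

  outer-walk : ∀ {p q} → Outer n p q ⊆ P → ∀ {a b} → Outer n p q a → Outer n p q b → a ⇝ b
  outer-walk O⊆P (inj₁ Ba) (inj₁ Bb) = convex-walk below-convex (O⊆P ∘ inj₁) Ba Bb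
  outer-walk O⊆P (inj₂ Aa) (inj₂ Ab) = convex-walk above-convex (O⊆P ∘ inj₂) Aa Ab
  outer-walk O⊆P (inj₁ Ba) (inj₂ Ab) = below-to-above O⊆P Ba Ab
  outer-walk O⊆P (inj₂ Aa) (inj₁ Bb) = reverse Adj-sym (O⊆P (inj₁ Bb)) (below-to-above O⊆P Bb Aa)

ArcsLinked : ℕ → List (ℕ × ℕ) → ℕ → ℕ → Set
ArcsLinked n L p q = ∃₂ λ x y → Inner n p q x × Adj n L x y × Outer n p q y

arcs-linked-by-first-last : ∀ {n L q u v} → Inner n 0 q u → Outer n 0 q v →
                            ArcsLinked n L 0 q
arcs-linked-by-first-last {n} ((1≤u , u≤n) , _ , u<q) (inj₂ ((_ , v≤n) , q<v)) =
  1 , n , ((≤-refl , 1≤n) , z<s , ≤-<-trans 1≤u u<q) ,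
  inj₁ (inj₂ (inj₂ (inj₁ (refl , refl)))) , inj₂ ((1≤n , ≤-refl) , <-≤-trans q<v v≤n)
  where
  1≤n : 1 ≤ n
  1≤n = ≤-trans 1≤u u≤n

arcs-linked-by-last-first : ∀ {n L p q u v} → n < q → Inner n p q u → Outer n p q v →
                            ArcsLinked n L p q
arcs-linked-by-last-first {n} n<q ((_ , u≤n) , p<u , _) (inj₁ ((1≤v , v≤n) , v<p)) =
  n , 1 , ((1≤n , ≤-refl) , <-≤-trans p<u u≤n , n<q) ,
  inj₁ (inj₂ (inj₂ (inj₂ (refl , refl)))) , inj₁ ((≤-refl , 1≤n) , ≤-<-trans 1≤v v<p)
  where
  1≤n : 1 ≤ n
  1≤n = ≤-trans 1≤v v≤n
arcs-linked-by-last-first n<q _ (inj₂ ((_ , v≤n) , q<v)) = ⊥-elim (<⇒≱ (<-trans n<q q<v) v≤n)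

inner-outer-chord : ∀ {n p q u v} → 1 ≤ p → q ≤ n → Inner n p q u → Outer n p q v →
                    IsChord n (p , q)
inner-outer-chord {n} {p} {q} 1≤p q≤n (_ , p<u , u<q) Ov =
  1≤p , <-trans p<u u<q , q≤n , <⇒≢ (≤-<-trans p<u u<q) , not-ends Ov
  where
  not-ends : ∀ {v} → Outer n p q v → ¬ (p ≡ 1 × q ≡ n)
  not-ends (inj₁ ((1≤v , _) , v<p)) (refl , _) = <⇒≱ v<p 1≤v
  not-ends (inj₂ ((_ , v≤n) , q<v)) (_ , refl) = <⇒≱ q<v v≤n

arcs-linked-by-link : ∀ {n L p q u v} → All (IsChord n) L → AllChordsCrossed n L →
                      1 ≤ p → q ≤ n → Inner n p q u → Outer n p q v →
                      ArcsLinked n L p q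
arcs-linked-by-link {p = p} {q} chords crossed 1≤p q≤n Iu Ov
  with crossed (p , q) (inner-outer-chord 1≤p q≤n Iu Ov)
... | (x , y) , xy∈L , inj₁ (p<x , x<q , q<y) =
  let (1≤x , x<y , y≤n , _) = All.lookup chords xy∈L in
  x , y , ((1≤x , <⇒≤ (<-≤-trans x<y y≤n)) , p<x , x<q) , inj₂ (inj₁ xy∈L) ,
  inj₂ ((≤-trans 1≤x (<⇒≤ x<y) , y≤n) , q<y)
... | (x , y) , xy∈L , inj₂ (x<p , p<y , y<q) =
  let (1≤x , x<y , y≤n , _) = All.lookup chords xy∈L in
  y , x , ((≤-trans 1≤x (<⇒≤ x<y) , y≤n) , p<y , y<q) , inj₂ (inj₂ xy∈L) ,
  inj₁ ((1≤x , <⇒≤ (<-≤-trans x<y y≤n)) , x<p)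

-- p = 0 or q > n means fewer than two vertices are deleted; then the edge {1,n} joins the arcs.
arcs-linked : ∀ {n L p q u v} → All (IsChord n) L → AllChordsCrossed n L →
              Inner n p q u → Outer n p q v →
              ArcsLinked n L p q
arcs-linked {p = zero}  chords crossed Iu Ov = arcs-linked-by-first-last Iu Ov
arcs-linked {n} {p = suc _} {q} chords crossed Iu Ov with q ≤? n
... | yes q≤n = arcs-linked-by-link chords crossed z<s q≤n Iu Ov
... | no  q≰n = arcs-linked-by-last-first (≰⇒> q≰n) Iu Ov

Avoids : ℕ → ℕ → ℕ → ℕ → Set
Avoids n p q w = Vertex n w × w ≢ p × w ≢ q

module _ {n p q : ℕ} (p≤q : p ≤ q) where

  avoids-split : Avoids n p q ⊆ λ w → Inner n p q w ⊎ Outer n p q w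
  avoids-split {w} (Vw , w≢p , w≢q) with <-cmp w p | <-cmp w q
  ... | tri< w<p _ _ | _            = inj₂ (inj₁ (Vw , w<p))
  ... | tri≈ _ w≡p _ | _            = ⊥-elim (w≢p w≡p)
  ... | tri> _ _ p<w | tri< w<q _ _ = inj₁ (Vw , p<w , w<q)
  ... | tri> _ _ _   | tri≈ _ w≡q _ = ⊥-elim (w≢q w≡q)
  ... | tri> _ _ _   | tri> _ _ q<w = inj₂ (inj₂ (Vw , q<w))

  inner⇒avoids : Inner n p q ⊆ Avoids n p q
  inner⇒avoids (Vw , p<w , w<q) = Vw , >⇒≢ p<w , <⇒≢ w<q

  outer⇒avoids : Outer n p q ⊆ Avoids n p q
  outer⇒avoids (inj₁ (Vw , w<p)) = Vw , <⇒≢ w<p , <⇒≢ (<-≤-trans w<p p≤q)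
  outer⇒avoids (inj₂ (Vw , q<w)) = Vw , >⇒≢ (≤-<-trans p≤q q<w) , >⇒≢ q<w

  module _ {L : List (ℕ × ℕ)} (chords : All (IsChord n) L)
           (crossed : AllChordsCrossed n L) where
    open CycleWalks n L {Avoids n p q} proj₁

    inner-to-outer-walk : ∀ {u v} → Inner n p q u → Outer n p q v → u ⇝ v
    inner-to-outer-walk Iu Ov with arcs-linked chords crossed Iu Ov
    ... | x , y , Ix , xy , Oy =
      convex-walk inner-convex inner⇒avoids Iu Ix
        ◅◅ step xy (outer⇒avoids Oy) (outer-walk outer⇒avoids Oy Ov)

    avoiding-walk : ∀ {u v} → Avoids n p q u → Avoids n p q v → u ⇝ v
    avoiding-walk Au Av with avoids-split Au | avoids-split Av
    ... | inj₁ Iu | inj₁ Iv = convex-walk inner-convex inner⇒avoids Iu Iv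
    ... | inj₂ Ou | inj₂ Ov = outer-walk outer⇒avoids Ou Ov
    ... | inj₁ Iu | inj₂ Ov = inner-to-outer-walk Iu Ov
    ... | inj₂ Ou | inj₁ Iv = reverse Adj-sym Av (inner-to-outer-walk Iv Ou)

    connectedMinus-pair : ∀ {X} → (∀ {w} → Vertex n w → w ∉ X → w ≢ p × w ≢ q) →
                          (∀ {w} → w ≢ p → w ≢ q → w ∉ X) → ConnectedMinus n L X
    connectedMinus-pair ∉X⇒avoids avoids⇒∉X u v Vu u∉X Vv v∉X =
      map-walk (λ (Vw , w≢p , w≢q) → Vw , avoids⇒∉X w≢p w≢q)
        (avoiding-walk (Vu , ∉X⇒avoids Vu u∉X) (Vv , ∉X⇒avoids Vv v∉X))

feasible-if-crossed : ∀ {n L} → 4 ≤ n → All (IsChord n) L → AllChordsCrossed n L →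
                      Feasible n L
feasible-if-crossed {n} {L} 4≤n chords crossed = 4≤n , connectedMinus
  where
  connectedMinus : ∀ X → length X ≤ 2 → ConnectedMinus n L X
  connectedMinus [] _ = -- deleting the non-vertex 0 deletes nothing
    connectedMinus-pair z≤n chords crossed
      (λ (1≤w , _) _ → >⇒≢ 1≤w , >⇒≢ 1≤w) (λ _ _ ())
  connectedMinus (p ∷ []) _ =
    connectedMinus-pair ≤-refl chords crossed
      (λ _ w∉X → w∉X ∘ here , w∉X ∘ here) (λ { w≢p _ (here w≡p) → w≢p w≡p ; _ _ (there ()) })
  connectedMinus (p ∷ q ∷ []) _ with ≤-total p q
  ... | inj₁ p≤q = connectedMinus-pair p≤q chords crossed (λ _ → ∉-pair⁻) ∉-pair⁺
  ... | inj₂ q≤p = connectedMinus-pair q≤p chords crossed (λ _ → swap ∘ ∉-pair⁻) (flip ∉-pair⁺)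
  connectedMinus (_ ∷ _ ∷ _ ∷ _) (s≤s (s≤s ()))

-- A cycle edge leaving the open interval (a,b) would end at a or b, so only a link can.
leaving-edge-crosses : ∀ {n L a b w w′} → All (IsChord n) L → 1 ≤ a → b ≤ n →
                       Within a b w → ¬ Within a b w′ → w′ ≢ a → w′ ≢ b → Adj n L w w′ →
                       Σ (ℕ × ℕ) (λ l → l ∈ L × Cross l (a , b))
leaving-edge-crosses _ _ _ (a<w , w<b) out _ w′≢b (inj₁ (inj₁ (_ , refl , _))) =
  ⊥-elim (out (<-trans a<w (n<1+n _) , ≤∧≢⇒< w<b w′≢b))
leaving-edge-crosses _ _ _ (a<w , w<b) out w′≢a _ (inj₁ (inj₂ (inj₁ (_ , refl , _)))) =
  ⊥-elim (out (≤∧≢⇒< (≤-pred a<w) (w′≢a ∘ sym) , <-trans (n<1+n _) w<b))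
leaving-edge-crosses _ 1≤a _ (a<w , _) _ _ _ (inj₁ (inj₂ (inj₂ (inj₁ (refl , _))))) =
  ⊥-elim (<⇒≱ a<w 1≤a)
leaving-edge-crosses _ _ b≤n (_ , w<b) _ _ _ (inj₁ (inj₂ (inj₂ (inj₂ (refl , _))))) =
  ⊥-elim (<⇒≱ w<b b≤n)
leaving-edge-crosses {b = b} {w′ = w′} chords _ _ (a<w , w<b) out _ w′≢b (inj₂ (inj₁ ww′∈L))
  with <-cmp w′ b
... | tri< w′<b _ _ = ⊥-elim (out (<-trans a<w (proj₁ (proj₂ (All.lookup chords ww′∈L))) , w′<b))
... | tri≈ _ w′≡b _ = ⊥-elim (w′≢b w′≡b)
... | tri> _ _ b<w′ = _ , ww′∈L , inj₁ (a<w , w<b , b<w′)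
leaving-edge-crosses {a = a} {w′ = w′} chords _ _ (a<w , w<b) out w′≢a _ (inj₂ (inj₂ w′w∈L))
  with <-cmp w′ a
... | tri< w′<a _ _ = _ , w′w∈L , inj₂ (w′<a , a<w , w<b)
... | tri≈ _ w′≡a _ = ⊥-elim (w′≢a w′≡a)
... | tri> _ _ a<w′ = ⊥-elim (out (a<w′ , <-trans (proj₁ (proj₂ (All.lookup chords w′w∈L))) w<b))

vertex-outside-chord : ∀ {n a b} → IsChord n (a , b) →
                       ∃ λ t → Vertex n t × t ≢ a × t ≢ b × ¬ Within a b t
vertex-outside-chord {n} {a} (1≤a , a<b , b≤n , _ , not-ends) with a ≟ 1
... | yes refl = n , (1≤n , ≤-refl) , >⇒≢ a<n , (not-ends ∘ (refl ,_) ∘ sym) ,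
                 λ (_ , n<b) → <⇒≱ n<b b≤n
  where
  a<n : a < n
  a<n = <-≤-trans a<b b≤n
  1≤n : 1 ≤ n
  1≤n = <⇒≤ a<n
... | no a≢1 = 1 , (≤-refl , ≤-trans 1≤a (<⇒≤ (<-≤-trans a<b b≤n))) , a≢1 ∘ sym ,
               <⇒≢ (≤-<-trans 1≤a a<b) , λ (a<1 , _) → <⇒≱ a<1 1≤a

-- Remove a and b: the walk from a + 1 to a vertex outside [a,b] must leave (a,b) through a link.
crossed-if-feasible : ∀ {n L} → All (IsChord n) L → Feasible n L → AllChordsCrossed n L
crossed-if-feasible {n} chords (_ , connected) (a , b) ab@(1≤a , a<b , b≤n , 1+a≢b , _) =
  let (t , Vt , t≢a , t≢b , t-outside) = vertex-outside-chord ab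
      walk = connected (a ∷ b ∷ []) (s≤s (s≤s z≤n)) (suc a) t
               V[1+a] (∉-pair⁺ (>⇒≢ ≤-refl) 1+a≢b) Vt (∉-pair⁺ t≢a t≢b)
      (w , w′ , w-inside , ww′ , w′-outside , (_ , w′∉X)) =
        walk-exits (Within a b) (λ w → (a <? w) ×-dec (w <? b)) walk (≤-refl , 1+a<b) t-outside
      (w′≢a , w′≢b) = ∉-pair⁻ w′∉X
  in leaving-edge-crosses chords 1≤a b≤n w-inside w′-outside w′≢a w′≢b ww′
  where
  1+a<b : suc a < b
  1+a<b = ≤∧≢⇒< a<b 1+a≢b
  V[1+a] : Vertex n (suc a)
  V[1+a] = s≤s z≤n , <⇒≤ (<-≤-trans 1+a<b b≤n)

short-chord-crossers-touch-middle : ∀ {a x y} → Cross (x , y) (a , suc (suc a)) →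
                                    Incident (suc a) (x , y)
short-chord-crossers-touch-middle (inj₁ (a<x , x<2+a , _)) = inj₁ (≤-antisym a<x (≤-pred x<2+a))
short-chord-crossers-touch-middle (inj₂ (_ , a<y , y<2+a)) = inj₂ (≤-antisym a<y (≤-pred y<2+a))

chord-crossers-of-2n-touch-1 : ∀ {n x y} → IsChord n (x , y) → Cross (x , y) (2 , n) → Incident 1 (x , y)
chord-crossers-of-2n-touch-1 (_ , _ , y≤n , _) (inj₁ (_ , _ , n<y)) = ⊥-elim (<⇒≱ n<y y≤n)
chord-crossers-of-2n-touch-1 (1≤x , _) (inj₂ (x<2 , _)) = inj₁ (≤-antisym 1≤x (≤-pred x<2))

chord-crossers-of-1m-touch-1+m : ∀ {m x y} → IsChord (suc m) (x , y) → Cross (x , y) (1 , m) →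
                                 Incident (suc m) (x , y)
chord-crossers-of-1m-touch-1+m (_ , _ , y≤1+m , _) (inj₁ (_ , _ , m<y)) = inj₂ (≤-antisym m<y y≤1+m)
chord-crossers-of-1m-touch-1+m (1≤x , _) (inj₂ (x<1 , _)) = ⊥-elim (<⇒≱ x<1 1≤x)

module _ {n : ℕ} {L : List (ℕ × ℕ)} (chords : All (IsChord n) L)
         (crossed : AllChordsCrossed n L) where

  touched-by-crossers : ∀ {v} c → IsChord n c → (∀ {l} → IsChord n l → Cross l c → Incident v l) →
                        Σ (ℕ × ℕ) (λ l → l ∈ L × Incident v l)
  touched-by-crossers c c-chord touches with crossed c c-chord
  ... | l , l∈L , l-crosses = l , l∈L , touches (All.lookup chords l∈L) l-crosses

  incident-if-crossed : 4 ≤ n → ∀ {v} → Vertex n v → Σ (ℕ × ℕ) (λ l → l ∈ L × Incident v l)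
  incident-if-crossed 4≤n {suc zero} _ =
    touched-by-crossers (2 , n)
      (s≤s z≤n , ≤-trans (s≤s (s≤s (s≤s z≤n))) 4≤n , ≤-refl , <⇒≢ 4≤n , λ ())
      chord-crossers-of-2n-touch-1
  incident-if-crossed 4≤n {suc (suc j)} (_ , v≤n) with suc (suc j) ≟ n
  ... | yes refl =
    touched-by-crossers (1 , suc j)
      (≤-refl , m≤n⇒m≤1+n 2≤j , n≤1+n _ , <⇒≢ (s≤s 2≤j) , <⇒≢ (n<1+n _) ∘ proj₂)
      chord-crossers-of-1m-touch-1+m
    where
    2≤j : 2 ≤ j
    2≤j = ≤-pred (≤-pred 4≤n)
  ... | no v≢n =
    touched-by-crossers (suc j , suc (suc (suc j)))
      (s≤s z≤n , s≤s (n≤1+n _) , ≤∧≢⇒< v≤n v≢n , <⇒≢ (n<1+n _) ,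
       λ { (refl , refl) → <-irrefl refl 4≤n })
      (λ _ → short-chord-crossers-touch-middle)

endpoints : List (ℕ × ℕ) → List ℕ
endpoints L = map proj₁ L ++ map proj₂ L

length-endpoints : ∀ L → length (endpoints L) ≡ 2 * length L
length-endpoints L = begin
  length (map proj₁ L ++ map proj₂ L)        ≡⟨ length-++ (map proj₁ L) ⟩
  length (map proj₁ L) + length (map proj₂ L) ≡⟨ cong₂ _+_ (length-map proj₁ L) (length-map proj₂ L) ⟩
  length L + length L                         ≡⟨ cong (length L +_) (sym (+-identityʳ (length L))) ⟩
  2 * length L                                ∎
  where open ≡-Reasoning

∈-endpoints : ∀ {L v l} → l ∈ L → Incident v l → v ∈ endpoints L
∈-endpoints l∈L (inj₁ refl) = ∈-++⁺ˡ (∈-map⁺ proj₁ l∈L)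
∈-endpoints l∈L (inj₂ refl) = ∈-++⁺ʳ _ (∈-map⁺ proj₂ l∈L)

∈-delete : ∀ {v x : ℕ} ys {zs} → v ≢ x → v ∈ ys ++ x ∷ zs → v ∈ ys ++ zs
∈-delete ys v≢x v∈ with ∈-++⁻ ys v∈
... | inj₁ v∈ys         = ∈-++⁺ˡ v∈ys
... | inj₂ (here v≡x)   = ⊥-elim (v≢x v≡x)
... | inj₂ (there v∈zs) = ∈-++⁺ʳ ys v∈zs

covers-range⇒≤length : ∀ k {xs : List ℕ} → (∀ {v} → 1 ≤ v → v ≤ k → v ∈ xs) → k ≤ length xs
covers-range⇒≤length zero    covers = z≤n
covers-range⇒≤length (suc k) covers
  with ys , zs , refl ← ∈-∃++ (covers (s≤s z≤n) ≤-refl) =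
  subst (suc k ≤_) (sym (length-++-sucʳ ys (suc k) zs))
    (s≤s (covers-range⇒≤length k
      (λ 1≤v v≤k → ∈-delete ys (<⇒≢ (s≤s v≤k)) (covers 1≤v (m≤n⇒m≤1+n v≤k)))))

lemma1 : (n : ℕ) → 4 ≤ n →
    (S : List (ℕ × ℕ)) → All (IsChord n) S → Unique S → Feasible n S →
    (S' : List (ℕ × ℕ)) → Unique S' → (∀ l → l ∈ S' → l ∈ S) →
    (Feasible n S' ⇔ (∀ c → IsChord n c → Σ (ℕ × ℕ) (λ l → l ∈ S' × Cross l c)))
    × (Feasible n S' →
        (∀ v → Vertex n v → Σ (ℕ × ℕ) (λ l → l ∈ S' × Incident v l))
        × n ≤ 2 * length S')
lemma1 n 4≤n S S-chords _ _ S' _ S'⊆S =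
  mk⇔ (crossed-if-feasible chords) (feasible-if-crossed 4≤n chords) , consequences
  where
  chords : All (IsChord n) S'
  chords = All.tabulate (All.lookup S-chords ∘ S'⊆S _)

  consequences : Feasible n S' →
                 (∀ v → Vertex n v → Σ (ℕ × ℕ) (λ l → l ∈ S' × Incident v l)) × n ≤ 2 * length S'
  consequences feasible = incident , subst (n ≤_) (length-endpoints S') (covers-range⇒≤length n covered)
    where
    incident : ∀ v → Vertex n v → Σ (ℕ × ℕ) (λ l → l ∈ S' × Incident v l)
    incident v = incident-if-crossed chords (crossed-if-feasible chords feasible) 4≤n

    covered : ∀ {v} → 1 ≤ v → v ≤ n → v ∈ endpoints S'
    covered 1≤v v≤n = let (l , l∈S' , v∈l) = incident _ (1≤v , v≤n) in ∈-endpoints l∈S' v∈l
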